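{- Let $n\ge 1$, $k\ge 1$ and $t\ge r\ge 1$ be integers. Then $$\gamma_{t,r}(C_n^{(k)})=\begin{cases}1 & \text{if } n\le 2(t-r)k+1,\\ 2 & \text{if } 2(t-r)k+1<n\le (2t-r-1)k+1,\\ \left\lceil \frac{n}{(2t-r-1)k+1}\right\rceil & \text{if } n>(2t-r-1)k+1.\end{cases}$$
   Context: $C_n^{(k)}$ is the $k$-th power of the cycle on $n$ vertices: its vertex set is $\{v_0,\dots,v_{n-1}\}$ (indices mod $n$) and $v_iv_j$ is an edge iff $v_i\ne v_j$ and the cyclic distance $\min\{|i-j|,n-|i-j|\}$ is at most $k$. For a graph $G$ with graph distance $d$ and positive integers $t,r$, a set $\mathcal{T}\subseteq V(G)$ of towers is $(t,r)$ broadcast dominating if every vertex $v$ satisfies $\sum_{u\in\mathcal{T}}\max\{0,t-d(u,v)\}\ge r$. The $(t,r)$ broadcast domination number $\gamma_{t,r}(G)$ is the minimum cardinality of a $(t,r)$ broadcast dominating set. -}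

module Defs where

open import Data.Nat using (ℕ; zero; suc; _+_; _*_; _∸_; _≤_; _<_; _≤ᵇ_; ∣_-_∣; _⊓_; _/_)
open import Data.Bool using (Bool; true; false; _∧_; _∨_; not; if_then_else_)
open import Data.Fin using (Fin; toℕ)
open import Data.Fin.Subset using (Subset; ∣_∣)
open import Data.Fin.Subset.Properties using (_∈?_)
open import Data.List using (List; map; allFin)
open import Data.Nat.ListAction using (sum)
open import Data.Bool.ListAction using (any)
open import Relation.Nullary using (⌊_⌋)
open import Data.Fin.Properties using (_≟_)
open import Relation.Binary.PropositionalEquality using (_≡_)

Graph : ℕ → Set
Graph n = Fin n → Fin n → Bool

cycDist : {n : ℕ} → Fin n → Fin n → ℕ
cycDist {n} i j = ∣ toℕ i - toℕ j ∣ ⊓ (n ∸ ∣ toℕ i - toℕ j ∣)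

cyclePower : (n k : ℕ) → Graph n
cyclePower n k i j = not ⌊ i ≟ j ⌋ ∧ (cycDist i j ≤ᵇ k)

reach : {n : ℕ} → Graph n → ℕ → Fin n → Fin n → Bool
reach G zero    u w = ⌊ u ≟ w ⌋
reach G (suc m) u w = reach G m u w ∨ any (λ x → reach G m u x ∧ G x w) (allFin _)

firstFrom : (ℕ → Bool) → ℕ → ℕ → ℕ
firstFrom p i zero       = i
firstFrom p i (suc fuel) = if p i then i else firstFrom p (suc i) fuel

-- Graph distance: the least m such that v is reachable from u by a walk of
-- length ≤ m.  (In a graph on n vertices any reachable vertex is reachable
-- within n ∸ 1 steps, so searching m < n suffices; for connected graphs, such
-- as C_n^{(k)} with k ≥ 1, this is exactly the graph distance.)
dist : {n : ℕ} → Graph n → Fin n → Fin n → ℕ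
dist {n} G u v = firstFrom (λ m → reach G m u v) 0 n

signal : {n : ℕ} → Graph n → ℕ → Subset n → Fin n → ℕ
signal G t T v =
  sum (map (λ u → if ⌊ u ∈? T ⌋ then t ∸ dist G u v else 0) (allFin _))

IsBroadcastDominating : {n : ℕ} → Graph n → ℕ → ℕ → Subset n → Set
IsBroadcastDominating G t r T = ∀ v → r ≤ signal G t T v

record BroadcastDominationNumber {n : ℕ} (G : Graph n) (t r m : ℕ) : Set where
  field
    witness     : Subset n
    dominating  : IsBroadcastDominating G t r witness
    card        : ∣ witness ∣ ≡ m
    minimal     : ∀ T → IsBroadcastDominating G t r T → m ≤ ∣ T ∣

-- ⌈ a / (suc b) ⌉
ceilDiv : ℕ → ℕ → ℕ
ceilDiv a b = (a + b) / suc b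

-- Positions are read modulo n: `arc a c` is the clockwise distance from a to c and the cyclic
-- distance is the shorter of the two arcs, so a tower at cyclic distance d from a vertex is
-- ⌈d/k⌉ steps away and contributes t ∸ ⌈d/k⌉.  A tower alone serves every vertex within
-- (t−r)k, and two towers whose clockwise arc has length at most b = (2t−r−1)k+1 serve every
-- vertex on that arc, because x + y ≤ b forces ⌈x/k⌉ + ⌈y/k⌉ ≤ 2t−r.  This gives the
-- dominating sets {0}, {0,1} and the multiples of b.
-- Conversely, let g₁, …, g_m be the clockwise gaps between consecutive towers.  If g_i > b, the
-- vertex (t−1)k+1 before the end of that gap is more than (t−r)k from the tower starting the
-- gap, and more than (t−1)k from every other tower unless g_{i−1} + g_i ≤ 2(t−1)k+1; as it is
-- dominated, that inequality holds.  Hence min(g_{i−1}, b) + (g_i ∸ b) ≤ b for every i, and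
-- summing around the cycle gives n = Σ g_i ≤ m b.  The lower bounds 1 and 2 come from the
-- same observation applied to a single tower.

module Submission where

open import Defs
open import Data.Nat using (ℕ; suc; _+_; _*_; _∸_; _≤_; _<_)
open import Data.Product using (_×_)

open import Data.Bool using (Bool; true; false; T; _∧_; if_then_else_)
open import Data.Bool.Properties using (T-∧; T-∨; T-≡)
open import Data.Empty using (⊥-elim)
open import Data.Fin using (Fin; zero; suc; toℕ; fromℕ<)
open import Data.Fin.Properties using (toℕ<n; toℕ-fromℕ<; toℕ-injective)
open import Data.Fin.Subset using (Subset; _∈_; ∣_∣; ⁅_⁆)
open import Data.Fin.Subset.Properties
  using (_∈?_; x∈⁅x⁆; ∣⁅x⁆∣≡1; x∈p⇒∣p-x∣<∣p∣; x∈p∧x≢y⇒x∈p-y)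
open import Data.List using (List; []; _∷_; allFin; tabulate; map; length)
open import Data.List.Properties using (map-tabulate; length-map)
open import Data.List.Membership.Propositional using () renaming (_∈_ to _∈ₗ_)
open import Data.List.Membership.Propositional.Properties using (∈-allFin)
open import Data.List.Relation.Unary.All as All using (All; []; _∷_)
import Data.List.Relation.Unary.All.Properties as All
open import Data.List.Relation.Unary.AllPairs using (AllPairs; []; _∷_)
open import Data.List.Relation.Unary.Any as Any using (satisfied)
open import Data.List.Relation.Unary.Any.Properties using (any⁺; any⁻)
open import Data.List.Relation.Unary.Linked using (Linked; []; [-]; _∷_)
open import Data.Nat as ℕ
  using (zero; pred; z≤n; s≤s; z<s; _⊓_; _⊔_; ∣_-_∣; NonZero; _%_; _/_; >-nonZero; >-nonZero⁻¹)
open import Data.Nat.DivMod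
open import Data.Nat.ListAction using (sum)
open import Data.Nat.Properties
open import Data.Nat.Tactic.RingSolver using (solve-∀)
open import Data.Product using (∃-syntax; _,_; proj₁; proj₂)
open import Data.Sum using (_⊎_; inj₁; inj₂)
open import Data.Vec using ([]; _∷_; here; there)
import Data.Vec as Vec
open import Data.Vec.Properties using (lookup∘tabulate; lookup⇒[]=; []=⇒lookup)
open import Function.Base using (_∘_)
open import Function.Bundles using (Equivalence)
open import Relation.Nullary using (yes; no)
open import Relation.Nullary.Decidable using (⌊_⌋; toWitness; fromWitness; fromWitnessFalse)
open import Relation.Binary.PropositionalEquality

ceiling : ∀ k .{{_ : NonZero k}} x → ∃[ d ] x ≤ d * k × d * k < x + k
ceiling k zero = 0 , z≤n , >-nonZero⁻¹ k
ceiling k (suc x) with ceiling k x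
... | d , x≤dk , dk<x+k with suc x ≤? d * k
...   | yes sx≤dk = d , sx≤dk , ≤-trans dk<x+k (n≤1+n _)
...   | no sx≰dk = suc d , subst (suc x ≤_) (sym next) (+-monoˡ-≤ x (>-nonZero⁻¹ k))
                         , subst (_< suc x + k) (sym next) (s≤s (≤-reflexive (+-comm k x)))
  where
  next : suc d * k ≡ k + x
  next = cong (k +_) (sym (≤-antisym x≤dk (≤-pred (≰⇒> sx≰dk))))

ceiling-split : ∀ {x y} s k .{{_ : NonZero k}} → x + y ≤ suc (s * k) →
  ∃[ d₁ ] ∃[ d₂ ] x ≤ d₁ * k × y ≤ d₂ * k × d₁ + d₂ ≡ suc s
ceiling-split {x} {y} s k x+y≤ with ceiling k x
... | d₁ , x≤d₁k , d₁k<x+k = d₁ , suc s ∸ d₁ , x≤d₁k , y≤ , m+[n∸m]≡n d₁≤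
  where
  room : y + d₁ * k ≤ suc s * k
  room = ≤-pred (begin
    suc (y + d₁ * k)     ≡⟨ +-suc y (d₁ * k) ⟨
    y + suc (d₁ * k)     ≤⟨ +-monoʳ-≤ y d₁k<x+k ⟩
    y + (x + k)          ≡⟨ regroup y x k ⟩
    x + y + k            ≤⟨ +-monoˡ-≤ k x+y≤ ⟩
    suc (s * k + k)      ≡⟨ cong suc (+-comm (s * k) k) ⟩
    suc (suc s * k)      ∎)
    where
    open ≤-Reasoning
    regroup : ∀ y x k → y + (x + k) ≡ x + y + k
    regroup = solve-∀
  d₁≤ : d₁ ≤ suc s
  d₁≤ = *-cancelʳ-≤ d₁ (suc s) k (≤-trans (m≤n+m (d₁ * k) y) room)
  y≤ : y ≤ (suc s ∸ d₁) * k
  y≤ = subst (y ≤_) (sym (*-distribʳ-∸ k (suc s) d₁)) (m+n≤o⇒m≤o∸n y room)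

truncated-sum-≥ : ∀ {r t} d₁ d₂ → r ≤ t → d₁ + d₂ ≤ 2 * t ∸ r → r ≤ (t ∸ d₁) + (t ∸ d₂)
truncated-sum-≥ {r} {t} d₁ d₂ r≤t d₁+d₂≤ = begin
  r                              ≡⟨ m∸[m∸n]≡n r≤2t ⟨
  2 * t ∸ (2 * t ∸ r)            ≤⟨ ∸-monoʳ-≤ (2 * t) d₁+d₂≤ ⟩
  2 * t ∸ (d₁ + d₂)              ≤⟨ m≤n+o⇒m∸n≤o (2 * t) (d₁ + d₂) covered ⟩
  (t ∸ d₁) + (t ∸ d₂)            ∎
  where
  open ≤-Reasoning
  r≤2t : r ≤ 2 * t
  r≤2t = ≤-trans r≤t (m≤m+n t (t + 0))
  covered : 2 * t ≤ d₁ + d₂ + ((t ∸ d₁) + (t ∸ d₂))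
  covered = begin
    2 * t                                   ≡⟨ cong (t +_) (+-identityʳ t) ⟩
    t + t                                   ≤⟨ +-mono-≤ (m≤n+m∸n t d₁) (m≤n+m∸n t d₂) ⟩
    d₁ + (t ∸ d₁) + (d₂ + (t ∸ d₂))         ≡⟨ regroup d₁ d₂ (t ∸ d₁) (t ∸ d₂) ⟩
    d₁ + d₂ + ((t ∸ d₁) + (t ∸ d₂))         ∎
    where
    regroup : ∀ a b c d → a + c + (b + d) ≡ a + b + (c + d)
    regroup = solve-∀

m∸[1+[m∸n]]<n : ∀ {m n} → 1 ≤ n → n ≤ m → m ∸ suc (m ∸ n) < n
m∸[1+[m∸n]]<n {m} {suc n} _ n≤m = begin-strict
  m ∸ suc (m ∸ suc n)       ≡⟨ pred[m∸n]≡m∸[1+n] m (m ∸ suc n) ⟨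
  pred (m ∸ (m ∸ suc n))    ≡⟨ cong pred (m∸[m∸n]≡n n≤m) ⟩
  n                         <⟨ n<1+n n ⟩
  suc n                     ∎
  where open ≤-Reasoning

∸-telescope : ∀ {x y z} → x ≤ y → y ≤ z → (y ∸ x) + (z ∸ y) ≡ z ∸ x
∸-telescope {x} {y} {z} x≤y y≤z =
  trans (+-comm (y ∸ x) (z ∸ y)) (trans (sym (+-∸-assoc (z ∸ y) x≤y)) (cong (_∸ x) (m∸n+n≡m y≤z)))

m+n+[o∸n]≡m+o : ∀ m {n o} → n ≤ o → m + n + (o ∸ n) ≡ m + o
m+n+[o∸n]≡m+o m {n} {o} n≤o = trans (+-assoc m n (o ∸ n)) (cong (m +_) (m+[n∸m]≡n n≤o))

ceilDiv-least : ∀ {n m} K → n ≤ m * suc K → ceilDiv n K ≤ m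
ceilDiv-least {n} {m} K n≤ = ≤-pred (m<n*o⇒m/o<n (begin-strict
  n + K                  ≤⟨ +-monoˡ-≤ K n≤ ⟩
  m * suc K + K          <⟨ +-monoʳ-< (m * suc K) (n<1+n K) ⟩
  m * suc K + suc K      ≡⟨ +-comm (m * suc K) (suc K) ⟩
  suc m * suc K          ∎))
  where open ≤-Reasoning

≤-sum-tabulate : ∀ {m} (f : Fin m → ℕ) i → f i ≤ sum (tabulate f)
≤-sum-tabulate f zero = m≤m+n (f zero) _
≤-sum-tabulate f (suc i) = ≤-trans (≤-sum-tabulate (f ∘ suc) i) (m≤n+m _ (f zero))

+≤-sum-tabulate : ∀ {m} (f : Fin m → ℕ) {i j} → i ≢ j → f i + f j ≤ sum (tabulate f)
+≤-sum-tabulate f {zero} {zero} i≢j = ⊥-elim (i≢j refl)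
+≤-sum-tabulate f {zero} {suc j} i≢j = +-monoʳ-≤ (f zero) (≤-sum-tabulate (f ∘ suc) j)
+≤-sum-tabulate f {suc i} {zero} i≢j =
  subst (_≤ sum (tabulate f)) (+-comm (f zero) (f (suc i))) (+-monoʳ-≤ (f zero) (≤-sum-tabulate (f ∘ suc) i))
+≤-sum-tabulate f {suc i} {suc j} i≢j =
  ≤-trans (+≤-sum-tabulate (f ∘ suc) (λ i≡j → i≢j (cong suc i≡j))) (m≤n+m _ (f zero))

positive-term : ∀ {m} (f : Fin m → ℕ) → 0 < sum (tabulate f) → ∃[ i ] 0 < f i
positive-term {suc m} f sum>0 with f zero in f0
... | suc _ = zero , subst (0 <_) (sym f0) z<s
... | zero with positive-term (f ∘ suc) sum>0
...   | i , fi>0 = suc i , fi>0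

other-positive-term : ∀ {m} (f : Fin m → ℕ) i → f i < sum (tabulate f) → ∃[ j ] j ≢ i × 0 < f j
other-positive-term f zero fi<sum
  with positive-term (f ∘ suc)
         (+-cancelˡ-< (f zero) _ _ (subst (_< sum (tabulate f)) (sym (+-identityʳ (f zero))) fi<sum))
... | j , fj>0 = suc j , (λ ()) , fj>0
other-positive-term f (suc i) fi<sum with f zero in f0
... | suc _ = zero , (λ ()) , subst (0 <_) (sym f0) z<s
... | zero with other-positive-term (f ∘ suc) i fi<sum
...   | j , j≢i , fj>0 = suc j , (λ sj≡si → j≢i (Data.Fin.Properties.suc-injective sj≡si)) , fj>0

lastOr : ℕ → List ℕ → ℕ
lastOr z [] = z
lastOr z (x ∷ xs) = lastOr x xs

lastOr-maximum : ∀ {x xs u} → AllPairs _<_ (x ∷ xs) → u ∈ₗ x ∷ xs → u ≤ lastOr x xs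
lastOr-maximum {xs = []} _ (Any.here refl) = ≤-refl
lastOr-maximum {x} {y ∷ ys} (x<ys ∷ increasing) (Any.here refl) =
  ≤-trans (<⇒≤ (All.lookup x<ys (Any.here refl))) (lastOr-maximum increasing (Any.here refl))
lastOr-maximum {xs = y ∷ ys} (_ ∷ increasing) (Any.there u∈) = lastOr-maximum increasing u∈

length-increasing : ∀ {a c xs} → AllPairs _<_ xs → All (a ≤_) xs → All (_< c) xs → length xs ≤ c ∸ a
length-increasing [] [] [] = z≤n
length-increasing {a} {c} {x ∷ xs} (x<xs ∷ increasing) (a≤x ∷ _) (x<c ∷ xs<c) = begin
  suc (length xs)   ≤⟨ s≤s (length-increasing increasing x<xs xs<c) ⟩
  suc (c ∸ suc x)   ≡⟨ +-∸-assoc 1 x<c ⟨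
  c ∸ x             ≤⟨ ∸-monoʳ-≤ c a≤x ⟩
  c ∸ a             ∎
  where open ≤-Reasoning

allPairs-map : ∀ {P : ℕ → Set} {R S : ℕ → ℕ → Set} (f : ℕ → ℕ) →
  (∀ {x y} → P x → P y → R x y → S (f x) (f y)) →
  ∀ {xs} → All P xs → AllPairs R xs → AllPairs S (map f xs)
allPairs-map f preserves [] [] = []
allPairs-map f preserves (px ∷ pxs) (rx ∷ rxs) =
  All.map⁺ (All.zipWith (λ (py , r) → preserves px py r) (pxs , rx)) ∷ allPairs-map f preserves pxs rxs

module Amortization (b : ℕ) where

  Charge : ℕ → ℕ → Set
  Charge a c = a ⊓ b + (c ∸ b) ≤ b

  amortize : ∀ a gs → Linked Charge (a ∷ gs) → a ⊓ b + sum gs ≤ length gs * b + lastOr a gs ⊓ b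
  amortize a [] _ = ≤-reflexive (+-identityʳ (a ⊓ b))
  amortize a (c ∷ cs) (charge ∷ rest) = begin
    a ⊓ b + (c + sum cs)                             ≡⟨ cong (λ m → a ⊓ b + (m + sum cs)) split-c ⟨
    a ⊓ b + (c ⊓ b + (c ∸ b) + sum cs)                ≡⟨ regroup (a ⊓ b) (c ⊓ b) (c ∸ b) (sum cs) ⟩
    (a ⊓ b + (c ∸ b)) + (c ⊓ b + sum cs)              ≤⟨ +-mono-≤ charge (amortize c cs rest) ⟩
    b + (length cs * b + lastOr c cs ⊓ b)             ≡⟨ +-assoc b (length cs * b) _ ⟨
    suc (length cs) * b + lastOr c cs ⊓ b             ∎
    where
    open ≤-Reasoning
    split-c : c ⊓ b + (c ∸ b) ≡ c
    split-c = trans (cong (_+ (c ∸ b)) (⊓-comm c b)) (m⊓n+n∸m≡n b c)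
    regroup : ∀ x y z w → x + (y + z + w) ≡ (x + z) + (y + w)
    regroup = solve-∀

  charge-≤ : ∀ {a c} → c ≤ b → Charge a c
  charge-≤ {a} {c} c≤b =
    subst (_≤ b) (sym (trans (cong (a ⊓ b +_) (m≤n⇒m∸n≡0 c≤b)) (+-identityʳ _))) (m⊓n≤n a b)

  charge-+ : ∀ {a c} → b ≤ c → a + c ≤ b + b → Charge a c
  charge-+ {a} {c} b≤c a+c≤2b = begin
    a ⊓ b + (c ∸ b)   ≤⟨ +-monoˡ-≤ (c ∸ b) (m⊓n≤m a b) ⟩
    a + (c ∸ b)       ≡⟨ +-∸-assoc a b≤c ⟨
    a + c ∸ b         ≤⟨ m≤n+o⇒m∸n≤o (a + c) b a+c≤2b ⟩
    b                 ∎
    where open ≤-Reasoning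

  cyclic-amortization : ∀ z gs → Linked Charge (lastOr z gs ∷ gs) → sum gs ≤ length gs * b
  cyclic-amortization z [] _ = z≤n
  cyclic-amortization z (g ∷ gs) linked =
    +-cancelˡ-≤ (ℓ ⊓ b) (sum (g ∷ gs)) (length (g ∷ gs) * b)
      (subst (ℓ ⊓ b + sum (g ∷ gs) ≤_) (+-comm _ (ℓ ⊓ b)) (amortize ℓ (g ∷ gs) linked))
    where ℓ = lastOr g gs

∣∣≥1 : ∀ {m} {p : Subset m} {x} → x ∈ p → 1 ≤ ∣ p ∣
∣∣≥1 x∈p = ≤-trans (s≤s z≤n) (x∈p⇒∣p-x∣<∣p∣ x∈p)

∣∣≥2 : ∀ {m} {p : Subset m} {x y} → x ∈ p → y ∈ p → x ≢ y → 2 ≤ ∣ p ∣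
∣∣≥2 x∈p y∈p x≢y =
  ≤-trans (s≤s (∣∣≥1 (x∈p∧x≢y⇒x∈p-y y∈p (≢-sym x≢y)))) (x∈p⇒∣p-x∣<∣p∣ x∈p)

positionsFrom : ∀ {m} → ℕ → Subset m → List ℕ
positionsFrom o [] = []
positionsFrom o (true ∷ p) = o ∷ positionsFrom (suc o) p
positionsFrom o (false ∷ p) = positionsFrom (suc o) p

length-positionsFrom : ∀ {m} o (p : Subset m) → length (positionsFrom o p) ≡ ∣ p ∣
length-positionsFrom o [] = refl
length-positionsFrom o (true ∷ p) = cong suc (length-positionsFrom (suc o) p)
length-positionsFrom o (false ∷ p) = length-positionsFrom (suc o) p

∈-positionsFrom⁺ : ∀ {m} o {p : Subset m} {u} → u ∈ p → o + toℕ u ∈ₗ positionsFrom o p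
∈-positionsFrom⁺ o {true ∷ p} here = Any.here (+-identityʳ o)
∈-positionsFrom⁺ o {true ∷ p} {suc u} (there u∈p) =
  Any.there (subst (_∈ₗ positionsFrom (suc o) p) (sym (+-suc o (toℕ u))) (∈-positionsFrom⁺ (suc o) u∈p))
∈-positionsFrom⁺ o {false ∷ p} {suc u} (there u∈p) =
  subst (_∈ₗ positionsFrom (suc o) p) (sym (+-suc o (toℕ u))) (∈-positionsFrom⁺ (suc o) u∈p)

∈-positionsFrom⁻ : ∀ {m} o (p : Subset m) {x} → x ∈ₗ positionsFrom o p → ∃[ u ] u ∈ p × o + toℕ u ≡ x
∈-positionsFrom⁻ o (true ∷ p) (Any.here x≡o) = zero , here , trans (+-identityʳ o) (sym x≡o)
∈-positionsFrom⁻ o (true ∷ p) (Any.there x∈) with ∈-positionsFrom⁻ (suc o) p x∈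
... | u , u∈p , o+u≡x = suc u , there u∈p , trans (+-suc o (toℕ u)) o+u≡x
∈-positionsFrom⁻ o (false ∷ p) x∈ with ∈-positionsFrom⁻ (suc o) p x∈
... | u , u∈p , o+u≡x = suc u , there u∈p , trans (+-suc o (toℕ u)) o+u≡x

positionsFrom-increasing : ∀ {m} o (p : Subset m) → AllPairs _<_ (positionsFrom o p)
positionsFrom-increasing o [] = []
positionsFrom-increasing o (true ∷ p) =
  All.tabulate (λ x∈ → let _ , _ , o+u≡x = ∈-positionsFrom⁻ (suc o) p x∈
                       in subst (o <_) o+u≡x (s≤s (m≤m+n o _)))
  ∷ positionsFrom-increasing (suc o) p
positionsFrom-increasing o (false ∷ p) = positionsFrom-increasing (suc o) p

select : ∀ {m} → (ℕ → Bool) → Subset m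
select P = Vec.tabulate (λ i → P (toℕ i))

∈-select : ∀ {m} P {u : Fin m} → T (P (toℕ u)) → u ∈ select P
∈-select P {u} holds = lookup⇒[]= u (select P) (trans (lookup∘tabulate _ u) (Equivalence.to T-≡ holds))

select-positions : ∀ {m} P {x} → x ∈ₗ positionsFrom 0 (select {m} P) → T (P x) × x < m
select-positions {m} P x∈ with ∈-positionsFrom⁻ 0 (select P) x∈
... | u , u∈ , u≡x = subst (λ y → T (P y) × y < m) u≡x
  (Equivalence.from T-≡ (trans (sym (lookup∘tabulate _ u)) ([]=⇒lookup u∈)) , toℕ<n u)

∣select∣≤ : ∀ {m} P c → (∀ {x} → T (P x) → x < c) → ∣ select {m} P ∣ ≤ c
∣select∣≤ {m} P c below = subst (_≤ c) (length-positionsFrom 0 (select {m} P))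
  (length-increasing (positionsFrom-increasing 0 (select {m} P)) (All.tabulate (λ _ → z≤n))
    (All.tabulate (λ x∈ → below (proj₁ (select-positions {m} P x∈)))))

multiple : ∀ b .{{_ : NonZero b}} → ℕ → Bool
multiple b x = x % b ℕ.≡ᵇ 0

∣multiples∣≤ : ∀ {m} K → ∣ select {m} (multiple (suc K)) ∣ ≤ ceilDiv m K
∣multiples∣≤ {m} K = begin
  ∣ select {m} (multiple (suc K)) ∣  ≡⟨ length-positionsFrom 0 (select {m} (multiple (suc K))) ⟨
  length xs                   ≡⟨ length-map (_/ suc K) xs ⟨
  length (map (_/ suc K) xs)  ≤⟨ length-increasing increasing (All.tabulate (λ _ → z≤n))
                                   (All.map⁺ (All.tabulate bounded)) ⟩
  ceilDiv m K                 ∎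
  where
  open ≤-Reasoning
  xs = positionsFrom 0 (select {m} (multiple (suc K)))
  divisible : ∀ {x} → x ∈ₗ xs → x ≡ x / suc K * suc K
  divisible {x} x∈ = trans (m≡m%n+[m/n]*n x (suc K))
    (cong (_+ x / suc K * suc K) (≡ᵇ⇒≡ _ 0 (proj₁ (select-positions {m} (multiple (suc K)) x∈))))
  increasing : AllPairs _<_ (map (_/ suc K) xs)
  increasing = allPairs-map (_/ suc K)
    (λ {x} {y} x≡ y≡ x<y → *-cancelʳ-< (suc K) (x / suc K) (y / suc K) (subst₂ _<_ x≡ y≡ x<y))
    (All.tabulate divisible) (positionsFrom-increasing 0 (select {m} (multiple (suc K))))
  bounded : ∀ {x} → x ∈ₗ xs → x / suc K < ceilDiv m K
  bounded {x} x∈ = subst (_≤ ceilDiv m K) (m*n/n≡m (suc (x / suc K)) (suc K)) (/-monoˡ-≤ (suc K) (begin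
    suc (x / suc K) * suc K      ≡⟨ cong (suc K +_) (divisible x∈) ⟨
    suc (K + x)                  ≡⟨ cong suc (+-comm K x) ⟩
    suc x + K                    ≤⟨ +-monoˡ-≤ K (proj₂ (select-positions {m} (multiple (suc K)) x∈)) ⟩
    m + K                        ∎))


module Cyclic (n : ℕ) .{{_ : NonZero n}} where

  infix 4 _≡ₙ_
  _≡ₙ_ : ℕ → ℕ → Set
  x ≡ₙ y = x % n ≡ y % n

  ≡ₙ-+ʳ : ∀ {x y} z → x ≡ₙ y → x + z ≡ₙ y + z
  ≡ₙ-+ʳ {x} {y} z x≡y = begin
    (x + z) % n             ≡⟨ %-distribˡ-+ x z n ⟩
    (x % n + z % n) % n     ≡⟨ cong (λ w → (w + z % n) % n) x≡y ⟩
    (y % n + z % n) % n     ≡⟨ %-distribˡ-+ y z n ⟨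
    (y + z) % n             ∎
    where open ≡-Reasoning

  ≡ₙ-+ˡ : ∀ {x y} z → x ≡ₙ y → z + x ≡ₙ z + y
  ≡ₙ-+ˡ {x} {y} z x≡y =
    subst₂ _≡ₙ_ (+-comm x z) (+-comm y z) (≡ₙ-+ʳ z x≡y)

  %-≡ₙ : ∀ x → x % n ≡ₙ x
  %-≡ₙ x = m%n%n≡m%n x n

  ≡ₙ-cancelʳ-+ : ∀ {x y} z → x + z ≡ₙ y + z → x ≡ₙ y
  ≡ₙ-cancelʳ-+ {x} {y} z x+z≡y+z = begin
    x % n                      ≡⟨ [m+kn]%n≡m%n x z n ⟨
    (x + z * n) % n            ≡⟨ cong (_% n) (absorb x) ⟩
    (x + z + z * pred n) % n   ≡⟨ ≡ₙ-+ʳ (z * pred n) x+z≡y+z ⟩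
    (y + z + z * pred n) % n   ≡⟨ cong (_% n) (absorb y) ⟨
    (y + z * n) % n            ≡⟨ [m+kn]%n≡m%n y z n ⟩
    y % n                      ∎
    where
    open ≡-Reasoning
    distribute : ∀ w z p → w + z * suc p ≡ w + z + z * p
    distribute = solve-∀
    absorb : ∀ w → w + z * n ≡ w + z + z * pred n
    absorb w = trans (cong (λ m → w + z * m) (sym (suc-pred n))) (distribute w z (pred n))

  ≡ₙ⇒≡ : ∀ {x y} → x < n → y < n → x ≡ₙ y → x ≡ y
  ≡ₙ⇒≡ x<n y<n x≡y = subst₂ _≡_ (m<n⇒m%n≡m x<n) (m<n⇒m%n≡m y<n) x≡y

  arc : ℕ → ℕ → ℕ
  arc a c = (c + (n ∸ a)) % n

  arc<n : ∀ a c → arc a c < n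
  arc<n a c = m%n<n (c + (n ∸ a)) n

  arc-unique : ∀ {a c} d → a ≤ n → a + d ≡ₙ c → arc a c ≡ d % n
  arc-unique {a} {c} d a≤n a+d≡c = begin
    (c + (n ∸ a)) % n       ≡⟨ ≡ₙ-+ʳ (n ∸ a) a+d≡c ⟨
    (a + d + (n ∸ a)) % n   ≡⟨ cong (_% n) regroup ⟩
    (d + n) % n             ≡⟨ [m+n]%n≡m%n d n ⟩
    d % n                   ∎
    where
    open ≡-Reasoning
    regroup : a + d + (n ∸ a) ≡ d + n
    regroup = trans (cong (_+ (n ∸ a)) (+-comm a d)) (m+n+[o∸n]≡m+o d a≤n)

  arc≤ : ∀ {a c} d → a ≤ n → a + d ≡ₙ c → arc a c ≤ d
  arc≤ d a≤n a+d≡c = ≤-trans (≤-reflexive (arc-unique d a≤n a+d≡c)) (m%n≤m d n)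

  arc≡ : ∀ {a c d} → a ≤ n → d < n → a + d ≡ₙ c → arc a c ≡ d
  arc≡ {d = d} a≤n d<n a+d≡c = trans (arc-unique d a≤n a+d≡c) (m<n⇒m%n≡m d<n)

  arc-spec : ∀ {a} c → a ≤ n → a + arc a c ≡ₙ c
  arc-spec {a} c a≤n = begin
    (a + (c + (n ∸ a)) % n) % n   ≡⟨ ≡ₙ-+ˡ a (%-≡ₙ (c + (n ∸ a))) ⟩
    (a + (c + (n ∸ a))) % n       ≡⟨ cong (_% n) regroup ⟩
    (c + n) % n                   ≡⟨ [m+n]%n≡m%n c n ⟩
    c % n                         ∎
    where
    open ≡-Reasoning
    regroup : a + (c + (n ∸ a)) ≡ c + n
    regroup = begin
      a + (c + (n ∸ a))   ≡⟨ +-comm a (c + (n ∸ a)) ⟩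
      c + (n ∸ a) + a     ≡⟨ +-assoc c (n ∸ a) a ⟩
      c + (n ∸ a + a)     ≡⟨ cong (c +_) (m∸n+n≡m a≤n) ⟩
      c + n               ∎

  arc-self : ∀ {a} → a ≤ n → arc a a ≡ 0
  arc-self {a} a≤n = arc≡ a≤n (>-nonZero⁻¹ n) (cong (_% n) (+-identityʳ a))

  arc-≤ : ∀ {a c} → a ≤ c → c < n → arc a c ≡ c ∸ a
  arc-≤ {a} {c} a≤c c<n =
    arc≡ (≤-trans a≤c (<⇒≤ c<n)) (≤-<-trans (m∸n≤m c a) c<n) (cong (_% n) (m+[n∸m]≡n a≤c))

  arc-> : ∀ {a c} → c < a → a ≤ n → arc a c ≡ n + c ∸ a
  arc-> {a} {c} c<a a≤n = arc≡ a≤n short wraps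
    where
    short : n + c ∸ a < n
    short = subst (n + c ∸ a <_) (m+n∸n≡m n a) (∸-monoˡ-< (+-monoʳ-< n c<a) (≤-trans a≤n (m≤m+n n c)))
    wraps : a + (n + c ∸ a) ≡ₙ c
    wraps = begin
      (a + (n + c ∸ a)) % n   ≡⟨ cong (_% n) (m+[n∸m]≡n (≤-trans a≤n (m≤m+n n c))) ⟩
      (n + c) % n             ≡⟨ cong (_% n) (+-comm n c) ⟩
      (c + n) % n             ≡⟨ [m+n]%n≡m%n c n ⟩
      c % n                   ∎
      where open ≡-Reasoning

  arc≡0⇒≡ : ∀ {a c} → a < n → c < n → arc a c ≡ 0 → a ≡ c
  arc≡0⇒≡ {a} {c} a<n c<n arc≡0 = ≡ₙ⇒≡ a<n c<n (begin
    a % n                 ≡⟨ cong (_% n) (+-identityʳ a) ⟨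
    (a + 0) % n           ≡⟨ cong (λ d → (a + d) % n) arc≡0 ⟨
    (a + arc a c) % n     ≡⟨ arc-spec c (<⇒≤ a<n) ⟩
    c % n                 ∎)
    where open ≡-Reasoning

  arc-sum : ∀ {a c} → a < n → c < n → a ≢ c → arc a c + arc c a ≡ n
  arc-sum {a} {c} a<n c<n a≢c = trans (cong (d +_) back) (m+[n∸m]≡n (<⇒≤ (arc<n a c)))
    where
    d = arc a c
    d>0 : 0 < d
    d>0 = n≢0⇒n>0 (λ d≡0 → a≢c (arc≡0⇒≡ a<n c<n d≡0))
    returns : c + (n ∸ d) ≡ₙ a
    returns = begin
      (c + (n ∸ d)) % n       ≡⟨ ≡ₙ-+ʳ (n ∸ d) (arc-spec c (<⇒≤ a<n)) ⟨
      (a + d + (n ∸ d)) % n   ≡⟨ cong (_% n) (m+n+[o∸n]≡m+o a (<⇒≤ (arc<n a c))) ⟩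
      (a + n) % n             ≡⟨ [m+n]%n≡m%n a n ⟩
      a % n                   ∎
      where open ≡-Reasoning
    back : arc c a ≡ n ∸ d
    back = arc≡ (<⇒≤ c<n) (∸-monoʳ-< d>0 (<⇒≤ (arc<n a c))) returns

  advance : ℕ → ℕ → ℕ
  advance a e = (a + e) % n

  advance<n : ∀ a e → advance a e < n
  advance<n a e = m%n<n (a + e) n

  arc-advance : ∀ {a} e → a ≤ n → arc a (advance a e) ≡ e % n
  arc-advance {a} e a≤n = arc-unique e a≤n (sym (%-≡ₙ (a + e)))

  arc-between : ∀ {a v c} → a ≤ n → v < n → arc a v ≤ arc a c → arc a v + arc v c ≡ arc a c
  arc-between {a} {v} {c} a≤n v<n e≤d = trans (cong (e +_) rest) (m+[n∸m]≡n e≤d)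
    where
    e = arc a v
    d = arc a c
    rest : arc v c ≡ d ∸ e
    rest = arc≡ (<⇒≤ v<n) (≤-<-trans (m∸n≤m d e) (arc<n a c)) (begin
      (v + (d ∸ e)) % n       ≡⟨ ≡ₙ-+ʳ (d ∸ e) (arc-spec v a≤n) ⟨
      (a + e + (d ∸ e)) % n   ≡⟨ cong (_% n) (m+n+[o∸n]≡m+o a e≤d) ⟩
      (a + d) % n             ≡⟨ arc-spec c a≤n ⟩
      c % n                   ∎)
      where open ≡-Reasoning

  arc-from-advance : ∀ {a c e} → a ≤ n → e ≤ arc a c → arc (advance a e) c ≡ arc a c ∸ e
  arc-from-advance {a} {c} {e} a≤n e≤d = begin
    arc v c                     ≡⟨ m+n∸m≡n e (arc v c) ⟨
    e + arc v c ∸ e             ≡⟨ cong (λ m → m + arc v c ∸ e) arc-v ⟨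
    arc a v + arc v c ∸ e       ≡⟨ cong (_∸ e) (arc-between a≤n (advance<n a e) (subst (_≤ arc a c) (sym arc-v) e≤d)) ⟩
    arc a c ∸ e                 ∎
    where
    open ≡-Reasoning
    v = advance a e
    arc-v : arc a v ≡ e
    arc-v = trans (arc-advance e a≤n) (m<n⇒m%n≡m (≤-<-trans e≤d (arc<n a c)))

  arc-advance-back : ∀ {a e} → a < n → 0 < e → e < n → arc (advance a e) a ≡ n ∸ e
  arc-advance-back {a} {e} a<n e>0 e<n =
    arc≡ (<⇒≤ (advance<n a e)) (∸-monoʳ-< e>0 (<⇒≤ e<n)) (begin
      (advance a e + (n ∸ e)) % n   ≡⟨ ≡ₙ-+ʳ (n ∸ e) (%-≡ₙ (a + e)) ⟩
      (a + e + (n ∸ e)) % n         ≡⟨ cong (_% n) (m+n+[o∸n]≡m+o a (<⇒≤ e<n)) ⟩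
      (a + n) % n                   ≡⟨ [m+n]%n≡m%n a n ⟩
      a % n                         ∎)
    where open ≡-Reasoning

  arc-to-advance : ∀ {u p e} → u < n → p < n → u ≢ p → e < arc p u →
    arc u (advance p e) ≡ arc u p + e
  arc-to-advance {u} {p} {e} u<n p<n u≢p e<arc =
    arc≡ (<⇒≤ u<n) short (begin
      (u + (arc u p + e)) % n   ≡⟨ cong (_% n) (+-assoc u (arc u p) e) ⟨
      (u + arc u p + e) % n     ≡⟨ ≡ₙ-+ʳ e (arc-spec p (<⇒≤ u<n)) ⟩
      (p + e) % n               ≡⟨ %-≡ₙ (p + e) ⟨
      advance p e % n           ∎)
    where
    open ≡-Reasoning
    short : arc u p + e < n
    short = subst (arc u p + e <_) (arc-sum u<n p<n u≢p) (+-monoʳ-< (arc u p) e<arc)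

  arc-complement : ∀ {a c} → a < n → c < n → a ≢ c → n ∸ arc a c ≡ arc c a
  arc-complement {a} {c} a<n c<n a≢c =
    trans (cong (_∸ arc a c) (sym (arc-sum a<n c<n a≢c))) (m+n∸m≡n (arc a c) (arc c a))

  ∣-∣≡arc : ∀ {a c} → c < n → a ≤ c → ∣ a - c ∣ ≡ arc a c
  ∣-∣≡arc c<n a≤c = trans (m≤n⇒∣m-n∣≡n∸m a≤c) (sym (arc-≤ a≤c c<n))

  -- `cycDist i j` unfolds to `cd (toℕ i) (toℕ j)`.
  cd : ℕ → ℕ → ℕ
  cd a c = ∣ a - c ∣ ⊓ (n ∸ ∣ a - c ∣)

  cd-self : ∀ a → cd a a ≡ 0
  cd-self a rewrite ∣n-n∣≡0 a = refl

  cd-comm : ∀ a c → cd a c ≡ cd c a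
  cd-comm a c rewrite ∣-∣-comm a c = refl

  cd≡arc⊓arc : ∀ {a c} → a < n → c < n → cd a c ≡ arc a c ⊓ arc c a
  cd≡arc⊓arc {a} {c} a<n c<n with a ℕ.≟ c
  ... | yes refl rewrite ∣n-n∣≡0 a | arc-self (<⇒≤ a<n) = refl
  ... | no a≢c with ≤-total a c
  ...   | inj₁ a≤c rewrite ∣-∣≡arc c<n a≤c = cong (arc a c ⊓_) (arc-complement a<n c<n a≢c)
  ...   | inj₂ c≤a rewrite ∣-∣-comm a c | ∣-∣≡arc a<n c≤a =
            trans (cong (arc c a ⊓_) (arc-complement c<n a<n (≢-sym a≢c))) (⊓-comm (arc c a) (arc a c))

  cd≤arc : ∀ {a c} → a < n → c < n → cd a c ≤ arc a c
  cd≤arc {a} {c} a<n c<n = subst (_≤ arc a c) (sym (cd≡arc⊓arc a<n c<n)) (m⊓n≤m _ _)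

  cd≤arc⁻ : ∀ {a c} → a < n → c < n → cd a c ≤ arc c a
  cd≤arc⁻ {a} {c} a<n c<n = subst (_≤ arc c a) (sym (cd≡arc⊓arc a<n c<n)) (m⊓n≤n _ _)

  cd-sel : ∀ {a c} → a < n → c < n → cd a c ≡ arc a c ⊎ cd a c ≡ arc c a
  cd-sel a<n c<n rewrite cd≡arc⊓arc a<n c<n = ⊓-sel _ _

  <cd : ∀ {m a c} → a < n → c < n → m < arc a c → m < arc c a → m < cd a c
  <cd {m} a<n c<n m<arc m<arc⁻ = subst (m <_) (sym (cd≡arc⊓arc a<n c<n)) (⊓-glb m<arc m<arc⁻)

  cd<n : ∀ {a c} → a < n → c < n → cd a c < n
  cd<n {a} {c} a<n c<n = ≤-<-trans (cd≤arc a<n c<n) (arc<n a c)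

  cd≡0⇒≡ : ∀ {a c} → a < n → c < n → cd a c ≡ 0 → a ≡ c
  cd≡0⇒≡ a<n c<n cd≡0 with cd-sel a<n c<n
  ... | inj₁ cd≡arc = arc≡0⇒≡ a<n c<n (trans (sym cd≡arc) cd≡0)
  ... | inj₂ cd≡arc⁻ = sym (arc≡0⇒≡ c<n a<n (trans (sym cd≡arc⁻) cd≡0))

  cd-≤-half : ∀ {a c} s → a < n → c < n → n ≤ s + s + 1 → cd a c ≤ s
  cd-≤-half {a} {c} s a<n c<n n≤ with a ℕ.≟ c
  ... | yes refl = subst (_≤ s) (sym (cd-self a)) z≤n
  ... | no a≢c = ≮⇒≥ λ s<cd → <⇒≱ (begin-strict
    s + s + 1                 <⟨ ≤-reflexive (double s) ⟩
    suc s + suc s             ≤⟨ +-mono-≤ s<cd s<cd ⟩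
    cd a c + cd a c           ≤⟨ +-mono-≤ (cd≤arc a<n c<n) (cd≤arc⁻ a<n c<n) ⟩
    arc a c + arc c a         ≡⟨ arc-sum a<n c<n a≢c ⟩
    n                         ∎) n≤
    where
    open ≤-Reasoning
    double : ∀ s → suc (s + s + 1) ≡ suc s + suc s
    double = solve-∀

  cd-≤ : ∀ {a c} x y → a < n → c < n → a + x ≡ₙ c + y → cd a c ≤ x + y
  cd-≤ {a} {c} x y a<n c<n a+x≡c+y with ≤-total y x
  ... | inj₁ y≤x = begin
    cd a c     ≤⟨ cd≤arc a<n c<n ⟩
    arc a c    ≤⟨ arc≤ (x ∸ y) (<⇒≤ a<n) (≡ₙ-cancelʳ-+ y (subst (_≡ₙ c + y) shift a+x≡c+y)) ⟩
    x ∸ y      ≤⟨ m∸n≤m x y ⟩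
    x          ≤⟨ m≤m+n x y ⟩
    x + y      ∎
    where
    open ≤-Reasoning
    shift : a + x ≡ a + (x ∸ y) + y
    shift = trans (cong (a +_) (sym (m∸n+n≡m y≤x))) (sym (+-assoc a (x ∸ y) y))
  ... | inj₂ x≤y = begin
    cd a c     ≤⟨ cd≤arc⁻ a<n c<n ⟩
    arc c a    ≤⟨ arc≤ (y ∸ x) (<⇒≤ c<n) (≡ₙ-cancelʳ-+ x (subst (_≡ₙ a + x) shift (sym a+x≡c+y))) ⟩
    y ∸ x      ≤⟨ m∸n≤m y x ⟩
    y          ≤⟨ m≤n+m y x ⟩
    x + y      ∎
    where
    open ≤-Reasoning
    shift : c + y ≡ c + (y ∸ x) + x
    shift = trans (cong (c +_) (sym (m∸n+n≡m x≤y))) (sym (+-assoc c (y ∸ x) x))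

  cd-witness : ∀ {a c} → a < n → c < n → ∃[ x ] ∃[ y ] x + y ≡ cd a c × a + x ≡ₙ c + y
  cd-witness {a} {c} a<n c<n with cd-sel a<n c<n
  ... | inj₁ cd≡arc = arc a c , 0 , trans (+-identityʳ _) (sym cd≡arc)
                    , trans (arc-spec c (<⇒≤ a<n)) (cong (_% n) (sym (+-identityʳ c)))
  ... | inj₂ cd≡arc⁻ = 0 , arc c a , sym cd≡arc⁻
                     , trans (cong (_% n) (+-identityʳ a)) (sym (arc-spec a (<⇒≤ c<n)))

  cd-triangle : ∀ {a b c} → a < n → b < n → c < n → cd a c ≤ cd a b + cd b c
  cd-triangle {a} {b} {c} a<n b<n c<n
    with cd-witness a<n b<n | cd-witness b<n c<n
  ... | x₁ , y₁ , s₁ , a+x₁≡b+y₁ | x₂ , y₂ , s₂ , b+x₂≡c+y₂ =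
    subst (cd a c ≤_) (trans (regroup x₁ y₁ x₂ y₂) (cong₂ _+_ s₁ s₂))
      (cd-≤ (x₁ + x₂) (y₂ + y₁) a<n c<n (begin
        (a + (x₁ + x₂)) % n   ≡⟨ cong (_% n) (+-assoc a x₁ x₂) ⟨
        (a + x₁ + x₂) % n     ≡⟨ ≡ₙ-+ʳ x₂ a+x₁≡b+y₁ ⟩
        (b + y₁ + x₂) % n     ≡⟨ cong (_% n) (swap b y₁ x₂) ⟩
        (b + x₂ + y₁) % n     ≡⟨ ≡ₙ-+ʳ y₁ b+x₂≡c+y₂ ⟩
        (c + y₂ + y₁) % n     ≡⟨ cong (_% n) (+-assoc c y₂ y₁) ⟩
        (c + (y₂ + y₁)) % n   ∎))
    where
    open ≡-Reasoning
    swap : ∀ b y x → b + y + x ≡ b + x + y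
    swap = solve-∀
    regroup : ∀ x₁ y₁ x₂ y₂ → x₁ + x₂ + (y₂ + y₁) ≡ x₁ + y₁ + (x₂ + y₂)
    regroup = solve-∀

  cd-split : ∀ {s t} e₁ e₂ → s < n → t < n → arc s t ≤ e₁ + e₂ →
    ∃[ x ] x < n × cd s x ≤ e₁ × cd x t ≤ e₂
  cd-split {s} {t} e₁ e₂ s<n t<n d≤e₁+e₂ = x , advance<n s e , near-s , near-t
    where
    d = arc s t
    e = e₁ ⊓ d
    x = advance s e
    near-s : cd s x ≤ e₁
    near-s = begin
      cd s x       ≤⟨ cd≤arc s<n (advance<n s e) ⟩
      arc s x      ≡⟨ arc-advance e (<⇒≤ s<n) ⟩
      e % n        ≤⟨ m%n≤m e n ⟩
      e            ≤⟨ m⊓n≤m e₁ d ⟩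
      e₁           ∎
      where open ≤-Reasoning
    near-t : cd x t ≤ e₂
    near-t = begin
      cd x t               ≤⟨ cd≤arc (advance<n s e) t<n ⟩
      arc x t              ≡⟨ arc-from-advance (<⇒≤ s<n) (m⊓n≤n e₁ d) ⟩
      d ∸ e                ≡⟨ ∸-distribˡ-⊓-⊔ d e₁ d ⟩
      (d ∸ e₁) ⊔ (d ∸ d)   ≤⟨ ⊔-lub (m≤n+o⇒m∸n≤o d e₁ d≤e₁+e₂) (subst (_≤ e₂) (sym (n∸n≡0 d)) z≤n) ⟩
      e₂                   ∎
      where open ≤-Reasoning

module Gaps (n : ℕ) .{{_ : NonZero n}} where

  open Cyclic n

  gaps : ℕ → ℕ → List ℕ → List ℕ
  gaps f x [] = n + f ∸ x ∷ []
  gaps f x (y ∷ ys) = y ∸ x ∷ gaps f y ys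

  length-gaps : ∀ f x ys → length (gaps f x ys) ≡ suc (length ys)
  length-gaps f x [] = refl
  length-gaps f x (y ∷ ys) = cong suc (length-gaps f y ys)

  lastOr-gaps : ∀ z f x ys → lastOr z (gaps f x ys) ≡ n + f ∸ lastOr x ys
  lastOr-gaps z f x [] = refl
  lastOr-gaps z f x (y ∷ ys) = lastOr-gaps (y ∸ x) f y ys

  sum-gaps : ∀ {f x} ys → f ≤ x → AllPairs _<_ (x ∷ ys) → All (_< n) (x ∷ ys) →
    sum (gaps f x ys) ≡ n + f ∸ x
  sum-gaps [] f≤x _ _ = +-identityʳ _
  sum-gaps {f} {x} (y ∷ ys) f≤x (x<ys ∷ increasing) (_ ∷ ys<n) =
    trans (cong (y ∸ x +_) (sum-gaps ys (≤-trans f≤x (<⇒≤ x<y)) increasing ys<n))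
          (∸-telescope (<⇒≤ x<y) (≤-trans (<⇒≤ (All.lookup ys<n (Any.here refl))) (m≤m+n n f)))
    where x<y = All.lookup x<ys (Any.here refl)

  Isolated : List ℕ → ℕ → ℕ → ℕ → Set
  Isolated ps A x B = B ≤ n × (∀ {u} → u ∈ₗ ps → u ≢ x → B ≤ arc x u × A ≤ arc u x)

  module _ {R : ℕ → ℕ → Set} {ps : List ℕ} {f : ℕ}
    (f≤ : ∀ {u} → u ∈ₗ ps → f ≤ u) (<n : ∀ {u} → u ∈ₗ ps → u < n)
    (isolated⇒R : ∀ {A x B} → x ∈ₗ ps → Isolated ps A x B → R A B) where

    gaps-linked : ∀ a x ys → AllPairs _<_ (x ∷ ys) → (∀ {u} → u ∈ₗ x ∷ ys → u ∈ₗ ps) →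
      (∀ {u} → u ∈ₗ ps → u ∈ₗ x ∷ ys ⊎ u < x) → (∀ {u} → u ∈ₗ ps → u ≢ x → a ≤ arc u x) →
      Linked R (a ∷ gaps f x ys)
    gaps-linked a x [] _ suffix located behind = isolated⇒R x∈ps (wrap≤n , clear) ∷ [-]
      where
      x∈ps = suffix (Any.here refl)
      wrap≤n : n + f ∸ x ≤ n
      wrap≤n = ≤-trans (∸-monoʳ-≤ (n + f) (f≤ x∈ps)) (≤-reflexive (m+n∸n≡m n f))
      clear : ∀ {u} → u ∈ₗ ps → u ≢ x → n + f ∸ x ≤ arc x u × a ≤ arc u x
      clear u∈ u≢x with located u∈
      ... | inj₁ (Any.here u≡x) = ⊥-elim (u≢x u≡x)
      ... | inj₂ u<x =
              subst (n + f ∸ x ≤_) (sym (arc-> u<x (<⇒≤ (<n x∈ps)))) (∸-monoˡ-≤ x (+-monoʳ-≤ n (f≤ u∈)))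
            , behind u∈ u≢x
    gaps-linked a x (y ∷ ys) (x<ys ∷ increasing@(y<ys ∷ _)) suffix located behind =
      isolated⇒R x∈ps (≤-trans (m∸n≤m y x) (<⇒≤ y<n) , clear)
      ∷ gaps-linked (y ∸ x) y ys increasing (λ u∈ → suffix (Any.there u∈)) located′ behind′
      where
      x∈ps = suffix (Any.here refl)
      x<y = All.lookup x<ys (Any.here refl)
      y<n = <n (suffix (Any.there (Any.here refl)))
      y≤ : ∀ {u} → u ∈ₗ y ∷ ys → y ≤ u
      y≤ (Any.here refl) = ≤-refl
      y≤ (Any.there u∈ys) = <⇒≤ (All.lookup y<ys u∈ys)
      clear : ∀ {u} → u ∈ₗ ps → u ≢ x → y ∸ x ≤ arc x u × a ≤ arc u x
      clear u∈ u≢x with located u∈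
      ... | inj₁ (Any.here u≡x) = ⊥-elim (u≢x u≡x)
      ... | inj₁ (Any.there u∈ys) =
              subst (y ∸ x ≤_) (sym (arc-≤ (≤-trans (<⇒≤ x<y) (y≤ u∈ys)) (<n u∈)))
                (∸-monoˡ-≤ x (y≤ u∈ys))
            , behind u∈ u≢x
      ... | inj₂ u<x =
              subst (y ∸ x ≤_) (sym (arc-> u<x (<⇒≤ (<n x∈ps))))
                (∸-monoˡ-≤ x (≤-trans (<⇒≤ y<n) (m≤m+n n _)))
            , behind u∈ u≢x
      located′ : ∀ {u} → u ∈ₗ ps → u ∈ₗ y ∷ ys ⊎ u < y
      located′ u∈ with located u∈
      ... | inj₁ (Any.here refl) = inj₂ x<y
      ... | inj₁ (Any.there u∈ys) = inj₁ u∈ys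
      ... | inj₂ u<x = inj₂ (<-trans u<x x<y)
      behind′ : ∀ {u} → u ∈ₗ ps → u ≢ y → y ∸ x ≤ arc u y
      behind′ {u} u∈ u≢y with located u∈
      ... | inj₁ (Any.here refl) = ≤-reflexive (sym (arc-≤ (<⇒≤ x<y) y<n))
      ... | inj₁ (Any.there u∈ys) = begin
        y ∸ x           ≤⟨ m∸n≤m y x ⟩
        y               ≤⟨ m≤n+m y (n ∸ u) ⟩
        n ∸ u + y       ≡⟨ +-∸-comm y (<⇒≤ (<n u∈)) ⟨
        n + y ∸ u       ≡⟨ arc-> (≤∧≢⇒< (y≤ u∈ys) (≢-sym u≢y)) (<⇒≤ (<n u∈)) ⟨
        arc u y         ∎
        where open ≤-Reasoning
      ... | inj₂ u<x =
        subst (y ∸ x ≤_) (sym (arc-≤ (<⇒≤ (<-trans u<x x<y)) y<n)) (∸-monoʳ-≤ y (<⇒≤ u<x))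

firstFrom-≤ : ∀ p {m} i fuel → T (p m) → i ≤ m → firstFrom p i fuel ≤ m
firstFrom-≤ p i zero pm i≤m = i≤m
firstFrom-≤ p {m} i (suc fuel) pm i≤m with p i in pi≡
... | true = i≤m
... | false with m≤n⇒m<n∨m≡n i≤m
...   | inj₁ i<m = firstFrom-≤ p (suc i) fuel pm i<m
...   | inj₂ refl rewrite pi≡ = ⊥-elim pm

firstFrom-found : ∀ p i fuel → T (p (firstFrom p i fuel)) ⊎ firstFrom p i fuel ≡ i + fuel
firstFrom-found p i zero = inj₂ (sym (+-identityʳ i))
firstFrom-found p i (suc fuel) with p i in pi≡
... | true rewrite pi≡ = inj₁ _
... | false with firstFrom-found p (suc i) fuel
...   | inj₁ found = inj₁ found
...   | inj₂ exhausted = inj₂ (trans exhausted (sym (+-suc i fuel)))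

module Distance (n k : ℕ) .{{_ : NonZero n}} .{{_ : NonZero k}} where

  open Cyclic n

  G : Graph n
  G = cyclePower n k

  edge : ∀ {x w} → x ≢ w → cycDist x w ≤ k → T (G x w)
  edge {x} {w} x≢w near = Equivalence.from T-∧ (fromWitnessFalse x≢w , ≤⇒≤ᵇ near)

  reach-sound : ∀ m u w → T (reach G m u w) → cycDist u w ≤ m * k
  reach-sound zero u w u≡w rewrite toWitness u≡w = ≤-reflexive (cd-self (toℕ w))
  reach-sound (suc m) u w reached with Equivalence.to T-∨ reached
  ... | inj₁ within-m = ≤-trans (reach-sound m u w within-m) (m≤n+m (m * k) k)
  ... | inj₂ via-some with satisfied (any⁻ _ (allFin n) via-some)
  ...   | x , u⇝x⇝w with Equivalence.to T-∧ u⇝x⇝w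
  ...     | u⇝x , x→w = begin
    cycDist u w                ≤⟨ cd-triangle (toℕ<n u) (toℕ<n x) (toℕ<n w) ⟩
    cycDist u x + cycDist x w  ≤⟨ +-mono-≤ (reach-sound m u x u⇝x) (≤ᵇ⇒≤ _ k (proj₂ (Equivalence.to T-∧ x→w))) ⟩
    m * k + k                  ≡⟨ +-comm (m * k) k ⟩
    suc m * k                  ∎
    where open ≤-Reasoning

  split : ∀ u w e₁ e₂ → arc (toℕ u) (toℕ w) ≤ e₁ + e₂ →
    ∃[ x ] cycDist u x ≤ e₁ × cycDist x w ≤ e₂
  split u w e₁ e₂ arc≤e₁+e₂ with cd-split e₁ e₂ (toℕ<n u) (toℕ<n w) arc≤e₁+e₂
  ... | x , x<n , ux , xw =
    fromℕ< x<n , subst (λ y → cd (toℕ u) y ≤ e₁) x≡ ux , subst (λ y → cd y (toℕ w) ≤ e₂) x≡ xw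
    where x≡ = sym (toℕ-fromℕ< x<n)

  stepping-stone : ∀ m u w → cycDist u w ≤ suc m * k →
    ∃[ x ] cycDist u x ≤ m * k × cycDist x w ≤ k
  stepping-stone m u w close with cd-sel (toℕ<n u) (toℕ<n w)
  ... | inj₁ cd≡arc =
    split u w (m * k) k (subst (_≤ m * k + k) cd≡arc (subst (cycDist u w ≤_) (+-comm k (m * k)) close))
  ... | inj₂ cd≡arc⁻ with split w u k (m * k) (subst (_≤ k + m * k) cd≡arc⁻ close)
  ...   | x , wx , xu =
    x , subst (_≤ m * k) (cd-comm (toℕ x) (toℕ u)) xu , subst (_≤ k) (cd-comm (toℕ w) (toℕ x)) wx

  reach-complete : ∀ m u w → cycDist u w ≤ m * k → T (reach G m u w)
  reach-complete zero u w cd≤0 =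
    fromWitness (toℕ-injective (cd≡0⇒≡ (toℕ<n u) (toℕ<n w) (n≤0⇒n≡0 cd≤0)))
  reach-complete (suc m) u w close with cycDist u w ≤? m * k
  ... | yes within-m = Equivalence.from T-∨ (inj₁ (reach-complete m u w within-m))
  ... | no beyond-m with stepping-stone m u w close
  ...   | x , ux , xw = Equivalence.from T-∨ (inj₂ (any⁺ _ (Any.map (λ { refl → hop }) (∈-allFin x))))
    where
    x≢w : x ≢ w
    x≢w refl = beyond-m ux
    hop : T (reach G m u x ∧ G x w)
    hop = Equivalence.from T-∧ (reach-complete m u x ux , edge x≢w xw)

  infixl 6 _⊕_
  _⊕_ : Fin n → ℕ → Fin n
  p ⊕ e = fromℕ< (advance<n (toℕ p) e)

  toℕ-⊕ : ∀ p e → toℕ (p ⊕ e) ≡ advance (toℕ p) e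
  toℕ-⊕ p e = toℕ-fromℕ< (advance<n (toℕ p) e)

  cycDist-⊕ : ∀ p {e} → 0 < e → e < n → cycDist p (p ⊕ e) ≡ e ⊓ (n ∸ e)
  cycDist-⊕ p {e} e>0 e<n rewrite toℕ-⊕ p e = begin
    cd (toℕ p) v                ≡⟨ cd≡arc⊓arc (toℕ<n p) (advance<n (toℕ p) e) ⟩
    arc (toℕ p) v ⊓ arc v (toℕ p) ≡⟨ cong₂ _⊓_ (trans (arc-advance e (<⇒≤ (toℕ<n p))) (m<n⇒m%n≡m e<n))
                                              (arc-advance-back (toℕ<n p) e>0 e<n) ⟩
    e ⊓ (n ∸ e)                 ∎
    where
    open ≡-Reasoning
    v = advance (toℕ p) e

  ⊕-clear-of : ∀ {p u A B x} → toℕ u ≢ toℕ p → x < B →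
    B ≤ arc (toℕ p) (toℕ u) → A ≤ arc (toℕ u) (toℕ p) →
    (B ∸ x) ⊓ (A + x) ≤ cycDist u (p ⊕ x)
  ⊕-clear-of {p} {u} {A} {B} {x} u≢p x<B B≤arc A≤arc rewrite toℕ-⊕ p x = begin
    (B ∸ x) ⊓ (A + x)                     ≤⟨ ⊓-mono-≤ ahead behind ⟩
    arc v (toℕ u) ⊓ arc (toℕ u) v         ≡⟨ ⊓-comm _ _ ⟩
    arc (toℕ u) v ⊓ arc v (toℕ u)         ≡⟨ cd≡arc⊓arc (toℕ<n u) (advance<n (toℕ p) x) ⟨
    cd (toℕ u) v                          ∎
    where
    open ≤-Reasoning
    v = advance (toℕ p) x
    x<arc : x < arc (toℕ p) (toℕ u)
    x<arc = <-≤-trans x<B B≤arc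
    ahead : B ∸ x ≤ arc v (toℕ u)
    ahead = subst (B ∸ x ≤_) (sym (arc-from-advance (<⇒≤ (toℕ<n p)) (<⇒≤ x<arc))) (∸-monoˡ-≤ x B≤arc)
    behind : A + x ≤ arc (toℕ u) v
    behind = subst (A + x ≤_) (sym (arc-to-advance (toℕ<n u) (toℕ<n p) u≢p x<arc)) (+-monoˡ-≤ x A≤arc)

  dist≤ : ∀ {u v} m → cycDist u v ≤ m * k → dist G u v ≤ m
  dist≤ {u} {v} m close = firstFrom-≤ (λ j → reach G j u v) 0 n (reach-complete m u v close) z≤n

  cycDist≤dist*k : ∀ u v → cycDist u v ≤ dist G u v * k
  cycDist≤dist*k u v with firstFrom-found (λ j → reach G j u v) 0 n
  ... | inj₁ found = reach-sound (dist G u v) u v found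
  ... | inj₂ exhausted rewrite exhausted = ≤-trans (<⇒≤ (cd<n (toℕ<n u) (toℕ<n v))) (m≤m*n n k)

  <dist : ∀ {u v} m → m * k < cycDist u v → m < dist G u v
  <dist {u} {v} m far = ≰⇒> λ dist≤m → <⇒≱ far (≤-trans (cycDist≤dist*k u v) (*-monoˡ-≤ k dist≤m))

module Broadcast (n k t r : ℕ) .{{_ : NonZero n}} .{{_ : NonZero k}} (1≤r : 1 ≤ r) (r≤t : r ≤ t) where

  open Cyclic n
  open Distance n k

  -- A tower alone serves the vertices within `solo`, and is heard at all only within `earshot`.
  solo earshot K : ℕ
  solo = (t ∸ r) * k
  earshot = (t ∸ 1) * k
  K = (2 * t ∸ r ∸ 1) * k

  open Amortization (suc K)
  open Gaps n

  1≤t : 1 ≤ t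
  1≤t = ≤-trans 1≤r r≤t

  origin : Fin n
  origin = fromℕ< (>-nonZero⁻¹ n)

  Dominating : Subset n → Set
  Dominating = IsBroadcastDominating G t r

  received : Subset n → Fin n → Fin n → ℕ
  received T v u = if ⌊ u ∈? T ⌋ then t ∸ dist G u v else 0

  signal≡sum : ∀ T v → signal G t T v ≡ sum (tabulate (received T v))
  signal≡sum T v = cong sum (map-tabulate (λ u → u) (received T v))

  received-∈ : ∀ {T u} v → u ∈ T → received T v u ≡ t ∸ dist G u v
  received-∈ {T} {u} v u∈T with u ∈? T
  ... | yes _ = refl
  ... | no u∉T = ⊥-elim (u∉T u∈T)

  received>0⇒∈ : ∀ {T u} v → 0 < received T v u → u ∈ T
  received>0⇒∈ {T} {u} v received>0 with u ∈? T
  ... | yes u∈T = u∈T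
  ... | no _ = ⊥-elim (<-irrefl refl received>0)

  ≤-signal : ∀ {T u} v → u ∈ T → t ∸ dist G u v ≤ signal G t T v
  ≤-signal {T} {u} v u∈T rewrite signal≡sum T v | sym (received-∈ v u∈T) =
    ≤-sum-tabulate (received T v) u

  span : 2 * t ∸ r ∸ 1 ≡ (t ∸ r) + (t ∸ 1)
  span = begin
    2 * t ∸ r ∸ 1       ≡⟨ cong (λ m → t + m ∸ r ∸ 1) (+-identityʳ t) ⟩
    t + t ∸ r ∸ 1       ≡⟨ cong (_∸ 1) (+-∸-comm t r≤t) ⟩
    t ∸ r + t ∸ 1       ≡⟨ +-∸-assoc (t ∸ r) 1≤t ⟩
    (t ∸ r) + (t ∸ 1)   ∎
    where open ≡-Reasoning

  suc-span : suc (2 * t ∸ r ∸ 1) ≡ 2 * t ∸ r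
  suc-span = sym (+-∸-assoc 1 (≤-trans 1≤t t≤2t∸r))
    where
    t≤2t∸r : t ≤ 2 * t ∸ r
    t≤2t∸r = subst (_≤ 2 * t ∸ r) (trans (m+n∸m≡n t (t + 0)) (+-identityʳ t)) (∸-monoʳ-≤ (2 * t) r≤t)

  K≡solo+earshot : K ≡ solo + earshot
  K≡solo+earshot = trans (cong (_* k) span) (*-distribʳ-+ k (t ∸ r) (t ∸ 1))

  solo≤earshot : solo ≤ earshot
  solo≤earshot = *-monoˡ-≤ k (∸-monoʳ-≤ t 1≤r)

  faint : ∀ {p v} → solo < cycDist p v → t ∸ dist G p v < r
  faint {p} {v} far = ≤-<-trans (∸-monoʳ-≤ t (<dist (t ∸ r) far)) (m∸[1+[m∸n]]<n 1≤r r≤t)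

  audible : ∀ {u v} → 0 < t ∸ dist G u v → cycDist u v ≤ earshot
  audible {u} {v} heard = ≤-trans (cycDist≤dist*k u v) (*-monoˡ-≤ k (m+n≤o⇒m≤o∸n (dist G u v) dist+1≤t))
    where
    dist+1≤t : dist G u v + 1 ≤ t
    dist+1≤t = subst (_≤ t) (+-comm 1 (dist G u v)) (m∸n≢0⇒n<m (λ t∸d≡0 → <-irrefl (sym t∸d≡0) heard))

  one-tower : ∀ {T u v} → u ∈ T → cycDist u v ≤ solo → r ≤ signal G t T v
  one-tower {T} {u} {v} u∈T near = begin
    r                 ≡⟨ m∸[m∸n]≡n r≤t ⟨
    t ∸ (t ∸ r)       ≤⟨ ∸-monoʳ-≤ t (dist≤ (t ∸ r) near) ⟩
    t ∸ dist G u v    ≤⟨ ≤-signal v u∈T ⟩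
    signal G t T v    ∎
    where open ≤-Reasoning

  two-towers : ∀ {T p q v} → p ∈ T → q ∈ T → p ≢ q →
    arc (toℕ p) (toℕ v) + arc (toℕ v) (toℕ q) ≤ suc K → r ≤ signal G t T v
  two-towers {T} {p} {q} {v} p∈T q∈T p≢q within with ceiling-split (2 * t ∸ r ∸ 1) k within
  ... | d₁ , d₂ , pv≤ , vq≤ , d₁+d₂≡ = begin
    r                                     ≤⟨ truncated-sum-≥ d₁ d₂ r≤t (≤-reflexive (trans d₁+d₂≡ suc-span)) ⟩
    (t ∸ d₁) + (t ∸ d₂)                   ≤⟨ +-mono-≤ (∸-monoʳ-≤ t (dist≤ d₁ p-near))
                                                      (∸-monoʳ-≤ t (dist≤ d₂ q-near)) ⟩
    (t ∸ dist G p v) + (t ∸ dist G q v)   ≡⟨ cong₂ _+_ (received-∈ v p∈T) (received-∈ v q∈T) ⟨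
    received T v p + received T v q       ≤⟨ +≤-sum-tabulate (received T v) p≢q ⟩
    sum (tabulate (received T v))         ≡⟨ signal≡sum T v ⟨
    signal G t T v                        ∎
    where
    open ≤-Reasoning
    p-near : cycDist p v ≤ d₁ * k
    p-near = ≤-trans (cd≤arc (toℕ<n p) (toℕ<n v)) pv≤
    q-near : cycDist q v ≤ d₂ * k
    q-near = ≤-trans (cd≤arc⁻ (toℕ<n q) (toℕ<n v)) vq≤

  some-tower : ∀ {T} → Dominating T → ∃[ u ] u ∈ T
  some-tower {T} dominating
    with positive-term (received T origin) (≤-trans 1≤r (subst (r ≤_) (signal≡sum T origin) (dominating origin)))
  ... | u , pos = u , received>0⇒∈ origin pos

  another-audible-tower : ∀ {T p v} → p ∈ T → solo < cycDist p v → r ≤ signal G t T v →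
    ∃[ u ] u ∈ T × u ≢ p × cycDist u v ≤ earshot
  another-audible-tower {T} {p} {v} p∈T far enough
    with other-positive-term (received T v) p
           (subst₂ _<_ (sym (received-∈ v p∈T)) (signal≡sum T v) (<-≤-trans (faint far) enough))
  ... | u , u≢p , heard with received>0⇒∈ v heard
  ...   | u∈T = u , u∈T , u≢p , audible (subst (0 <_) (received-∈ v u∈T) heard)

  tower : ∀ {P x} (x<n : x < n) → T (P x) → fromℕ< x<n ∈ select P
  tower {P} x<n holds = ∈-select P (subst (λ y → T (P y)) (sym (toℕ-fromℕ< x<n)) holds)

  between-towers : ∀ {T p q} v (p<n : p < n) (q<n : q < n) → fromℕ< p<n ∈ T → fromℕ< q<n ∈ T → p ≢ q →
    arc p (toℕ v) ≤ arc p q → arc p q ≤ suc K → r ≤ signal G t T v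
  between-towers {T} {p} {q} v p<n q<n p∈T q∈T p≢q between short =
    two-towers p∈T q∈T
      (λ same → p≢q (trans (sym (toℕ-fromℕ< p<n)) (trans (cong toℕ same) (toℕ-fromℕ< q<n))))
      (subst₂ (λ p′ q′ → arc p′ (toℕ v) + arc (toℕ v) q′ ≤ suc K)
        (sym (toℕ-fromℕ< p<n)) (sym (toℕ-fromℕ< q<n))
        (≤-trans (≤-reflexive (arc-between (<⇒≤ p<n) (toℕ<n v) between)) short))

  solo-dominates : n ≤ 2 * (t ∸ r) * k + 1 → Dominating ⁅ origin ⁆
  solo-dominates narrow v =
    one-tower (x∈⁅x⁆ origin)
      (cd-≤-half solo (toℕ<n origin) (toℕ<n v) (subst (n ≤_) (double (t ∸ r) k) narrow))
    where
    double : ∀ x k → 2 * x * k + 1 ≡ x * k + x * k + 1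
    double = solve-∀

  pair-dominates : 1 < n → n ≤ K + 1 → Dominating (select (ℕ._≤ᵇ 1))
  pair-dominates 1<n narrow v =
    between-towers v 1<n (>-nonZero⁻¹ n) (tower {ℕ._≤ᵇ 1} 1<n _) (tower {ℕ._≤ᵇ 1} (>-nonZero⁻¹ n) _)
      (λ ()) v-between short
    where
    wrap : arc 1 0 ≡ n ∸ 1
    wrap = trans (arc-> z<s 1<n′) (cong (_∸ 1) (+-identityʳ n))
      where 1<n′ = <⇒≤ 1<n
    v-between : arc 1 (toℕ v) ≤ arc 1 0
    v-between = subst (arc 1 (toℕ v) ≤_) (sym wrap)
      (m+n≤o⇒m≤o∸n (arc 1 (toℕ v)) (subst (_≤ n) (+-comm 1 _) (arc<n 1 (toℕ v))))
    short : arc 1 0 ≤ suc K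
    short = subst (_≤ suc K) (sym wrap) (≤-trans (m∸n≤m n 1) (subst (n ≤_) (+-comm K 1) narrow))

  block-dominated : ∀ {P} v → suc K < n → T (multiple (suc K) P) → P ≤ toℕ v → toℕ v < P + suc K →
    r ≤ signal G t (select (multiple (suc K))) v
  block-dominated {P} v wide P-multiple P≤i i<next with P + suc K <? n
  ... | yes next<n =
    between-towers v P<n next<n (tower {multiple (suc K)} P<n P-multiple)
      (tower {multiple (suc K)} next<n next-multiple) (<⇒≢ (m<m+n P z<s)) between (≤-reflexive period)
    where
    P<n = ≤-<-trans P≤i (toℕ<n v)
    next-multiple : T (multiple (suc K) (P + suc K))
    next-multiple = subst (λ m → T (m ℕ.≡ᵇ 0)) (sym ([m+n]%n≡m%n P (suc K))) P-multiple
    period : arc P (P + suc K) ≡ suc K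
    period = trans (arc-≤ (m≤m+n P (suc K)) next<n) (m+n∸m≡n P (suc K))
    between : arc P (toℕ v) ≤ arc P (P + suc K)
    between = subst₂ _≤_ (sym (arc-≤ P≤i (toℕ<n v))) (sym period)
      (m≤n+o⇒m∸n≤o (toℕ v) P (<⇒≤ i<next))
  ... | no next≮n =
    between-towers v P<n (>-nonZero⁻¹ n) (tower {multiple (suc K)} P<n P-multiple)
      (tower {multiple (suc K)} (>-nonZero⁻¹ n) _) P≢0 between short
    where
    P<n = ≤-<-trans P≤i (toℕ<n v)
    P≢0 : P ≢ 0
    P≢0 P≡0 = next≮n (subst (λ x → x + suc K < n) (sym P≡0) wide)
    wrap : arc P 0 ≡ n ∸ P
    wrap = trans (arc-> (n≢0⇒n>0 P≢0) (<⇒≤ P<n)) (cong (_∸ P) (+-identityʳ n))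
    between : arc P (toℕ v) ≤ arc P 0
    between = subst₂ _≤_ (sym (arc-≤ P≤i (toℕ<n v))) (sym wrap) (∸-monoˡ-≤ P (<⇒≤ (toℕ<n v)))
    short : arc P 0 ≤ suc K
    short = subst (_≤ suc K) (sym wrap) (m≤n+o⇒m∸n≤o n P (≮⇒≥ next≮n))

  multiples-dominate : suc K < n → Dominating (select (multiple (suc K)))
  multiples-dominate wide v = block-dominated v wide P-multiple (m/n*n≤m i (suc K)) i<next
    where
    i = toℕ v
    P-multiple : T (multiple (suc K) (i / suc K * suc K))
    P-multiple = ≡⇒≡ᵇ _ 0 (m*n%n≡0 (i / suc K) (suc K))
    i<next : i < i / suc K * suc K + suc K
    i<next = subst (_< i / suc K * suc K + suc K) (sym (trans (m≡m%n+[m/n]*n i (suc K)) (+-comm (i % suc K) _)))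
               (+-monoʳ-< (i / suc K * suc K) (m%n<n i (suc K)))

  at-least-one : ∀ {T} → Dominating T → 1 ≤ ∣ T ∣
  at-least-one dominating = ∣∣≥1 (proj₂ (some-tower dominating))

  far-point : 2 * (t ∸ r) * k + 1 < n → ∀ p → solo < cycDist p (p ⊕ suc solo)
  far-point wide p = subst (solo <_) (sym (cycDist-⊕ p z<s (<-≤-trans (s≤s (m≤n+m (suc solo) solo)) room)))
    (⊓-glb ≤-refl (m+n≤o⇒m≤o∸n (suc solo) room))
    where
    room : suc solo + suc solo ≤ n
    room = subst (_≤ n) (double (t ∸ r) k) wide
      where
      double : ∀ x k → suc (2 * x * k + 1) ≡ suc (x * k) + suc (x * k)
      double = solve-∀

  at-least-two : ∀ {T} → 2 * (t ∸ r) * k + 1 < n → Dominating T → 2 ≤ ∣ T ∣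
  at-least-two wide dominating with some-tower dominating
  ... | p , p∈T with another-audible-tower p∈T (far-point wide p) (dominating (p ⊕ suc solo))
  ...   | u , u∈T , u≢p , _ = ∣∣≥2 p∈T u∈T (≢-sym u≢p)

  Spaced : Subset n → ℕ → Fin n → ℕ → Set
  Spaced T A p B = ∀ {u} → u ∈ T → u ≢ p → B ≤ arc (toℕ p) (toℕ u) × A ≤ arc (toℕ u) (toℕ p)

  quiet-point : ∀ {T p A B} → p ∈ T → B ≤ n → Spaced T A p B →
    suc K < B → earshot + earshot + 1 < A + B →
    solo < cycDist p (p ⊕ (B ∸ suc earshot))
    × (∀ {u} → u ∈ T → u ≢ p → earshot < cycDist u (p ⊕ (B ∸ suc earshot)))
  quiet-point {T} {p} {A} {B} p∈T B≤n clear wide long = p-far , others-far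
    where
    e = earshot
    x = B ∸ suc e
    wide′ : suc solo + suc e ≤ B
    wide′ = subst (_< B) (trans (cong suc K≡solo+earshot) (sym (+-suc solo e))) wide
    e<B : suc e ≤ B
    e<B = ≤-trans (m≤n+m (suc e) (suc solo)) wide′
    x<B : x < B
    x<B = ∸-monoʳ-< z<s e<B
    x<n : x < n
    x<n = <-≤-trans x<B B≤n
    solo<x : solo < x
    solo<x = m+n≤o⇒m≤o∸n (suc solo) wide′
    B∸x : B ∸ x ≡ suc e
    B∸x = m∸[m∸n]≡n e<B
    p-far : solo < cycDist p (p ⊕ x)
    p-far = subst (solo <_) (sym (cycDist-⊕ p (≤-<-trans z≤n solo<x) x<n))
      (⊓-glb solo<x (≤-trans (s≤s solo≤earshot) (subst (_≤ n ∸ x) B∸x (∸-monoˡ-≤ x B≤n))))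
    others-far : ∀ {u} → u ∈ T → u ≢ p → e < cycDist u (p ⊕ x)
    others-far u∈T u≢p = <-≤-trans (⊓-glb (≤-reflexive (sym B∸x)) e<A+x)
      (⊕-clear-of (λ u≡p → u≢p (toℕ-injective u≡p)) x<B (proj₁ (clear u∈T u≢p))
        (proj₂ (clear u∈T u≢p)))
      where
      e<A+x : e < A + x
      e<A+x = subst (e <_) (+-∸-assoc A e<B) (m+n≤o⇒m≤o∸n (suc e) (subst (_≤ A + B) (double e) long))
        where
        double : ∀ e → suc (e + e + 1) ≡ suc e + suc e
        double = solve-∀

  wide-gap-excluded : ∀ {T p A B} → Dominating T → p ∈ T → B ≤ n → Spaced T A p B →
    suc K < B → A + B ≤ earshot + earshot + 1
  wide-gap-excluded {T} {p} {A} {B} dominating p∈T B≤n clear wide with A + B ≤? earshot + earshot + 1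
  ... | yes short = short
  ... | no long with quiet-point p∈T B≤n clear wide (≰⇒> long)
  ...   | p-far , others-far with another-audible-tower p∈T p-far (dominating _)
  ...     | u , u∈T , u≢p , near = ⊥-elim (<⇒≱ (others-far u∈T u≢p) near)

  isolated-charge : ∀ {T p A B} → Dominating T → p ∈ T → B ≤ n → Spaced T A p B → Charge A B
  isolated-charge {B = B} dominating p∈T B≤n clear with B ≤? suc K
  ... | yes narrow = charge-≤ narrow
  ... | no wide =
    charge-+ (<⇒≤ (≰⇒> wide)) (≤-trans (wide-gap-excluded dominating p∈T B≤n clear (≰⇒> wide)) fits)
    where
    e≤K : earshot ≤ K
    e≤K = subst (earshot ≤_) (sym K≡solo+earshot) (m≤n+m earshot solo)
    fits : earshot + earshot + 1 ≤ suc K + suc K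
    fits = ≤-trans (+-monoˡ-≤ 1 (+-mono-≤ e≤K e≤K)) (≤-trans (n≤1+n _) (≤-reflexive (double K)))
      where
      double : ∀ K → suc (K + K + 1) ≡ suc K + suc K
      double = solve-∀

  gap-bound : ∀ {T} → Dominating T → n ≤ ∣ T ∣ * suc K
  gap-bound {T} dominating
    with positionsFrom 0 T in ps≡ | ∈-positionsFrom⁺ 0 (proj₂ (some-tower dominating))
  ... | [] | ()
  ... | x ∷ xs | _ = begin
    n                   ≡⟨ m+n∸n≡m n x ⟨
    n + x ∸ x           ≡⟨ sum-gaps xs ≤-refl increasing (All.tabulate <n) ⟨
    sum gs              ≤⟨ cyclic-amortization 0 gs
                             (subst (λ a → Linked Charge (a ∷ gs)) (sym (lastOr-gaps 0 x x xs)) linked) ⟩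
    length gs * suc K   ≡⟨ cong (_* suc K) (trans (length-gaps x x xs) count) ⟩
    ∣ T ∣ * suc K       ∎
    where
    open ≤-Reasoning
    gs = gaps x x xs
    count : suc (length xs) ≡ ∣ T ∣
    count = trans (cong length (sym ps≡)) (length-positionsFrom 0 T)
    increasing : AllPairs _<_ (x ∷ xs)
    increasing = subst (AllPairs _<_) ps≡ (positionsFrom-increasing 0 T)
    tower-at : ∀ {y} → y ∈ₗ x ∷ xs → ∃[ w ] w ∈ T × toℕ w ≡ y
    tower-at {y} y∈ = ∈-positionsFrom⁻ 0 T (subst (y ∈ₗ_) (sym ps≡) y∈)
    position-of : ∀ {w} → w ∈ T → toℕ w ∈ₗ x ∷ xs
    position-of {w} w∈T = subst (toℕ w ∈ₗ_) ps≡ (∈-positionsFrom⁺ 0 w∈T)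
    <n : ∀ {y} → y ∈ₗ x ∷ xs → y < n
    <n y∈ with tower-at y∈
    ... | w , _ , refl = toℕ<n w
    x≤ : ∀ {y} → y ∈ₗ x ∷ xs → x ≤ y
    x≤ (Any.here refl) = ≤-refl
    x≤ (Any.there y∈) with increasing
    ... | x<xs ∷ _ = <⇒≤ (All.lookup x<xs y∈)
    charge : ∀ {A y B} → y ∈ₗ x ∷ xs → Isolated (x ∷ xs) A y B → Charge A B
    charge y∈ (B≤n , clear) with tower-at y∈
    ... | w , w∈T , refl = isolated-charge dominating w∈T B≤n
            (λ u∈T u≢w → clear (position-of u∈T) (λ same → u≢w (toℕ-injective same)))
    wrap-behind : ∀ {u} → u ∈ₗ x ∷ xs → u ≢ x → n + x ∸ lastOr x xs ≤ arc u x
    wrap-behind {u} u∈ u≢x =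
      subst (n + x ∸ lastOr x xs ≤_) (sym (arc-> (≤∧≢⇒< (x≤ u∈) (≢-sym u≢x)) (<⇒≤ (<n u∈))))
        (∸-monoʳ-≤ (n + x) (lastOr-maximum increasing u∈))
    linked : Linked Charge (n + x ∸ lastOr x xs ∷ gs)
    linked = gaps-linked x≤ <n charge (n + x ∸ lastOr x xs) x xs increasing (λ u∈ → u∈) inj₁ wrap-behind

optimal : ∀ {n} {G : Graph n} {t r W m} → IsBroadcastDominating G t r W → ∣ W ∣ ≤ m →
  (∀ {T} → IsBroadcastDominating G t r T → m ≤ ∣ T ∣) → BroadcastDominationNumber G t r m
optimal {W = W} dominating small minimal = record
  { witness = W ; dominating = dominating ; card = ≤-antisym small (minimal dominating) ; minimal = λ _ → minimal }

theorem3 : (n k t r : ℕ) → 1 ≤ n → 1 ≤ k → 1 ≤ r → r ≤ t →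
    (n ≤ 2 * (t ∸ r) * k + 1 → BroadcastDominationNumber (cyclePower n k) t r 1)
    × (2 * (t ∸ r) * k + 1 < n → n ≤ (2 * t ∸ r ∸ 1) * k + 1 →
         BroadcastDominationNumber (cyclePower n k) t r 2)
    × ((2 * t ∸ r ∸ 1) * k + 1 < n →
         BroadcastDominationNumber (cyclePower n k) t r
           (ceilDiv n ((2 * t ∸ r ∸ 1) * k)))
theorem3 n k t r 1≤n 1≤k 1≤r r≤t =
    (λ narrow → optimal (solo-dominates narrow) (≤-reflexive (∣⁅x⁆∣≡1 origin)) at-least-one)
  , (λ wide narrow → optimal (pair-dominates (≤-trans (s≤s (m≤n+m 1 _)) wide) narrow)
                             (∣select∣≤ {n} (ℕ._≤ᵇ 1) 2 (λ {x} below → s≤s (≤ᵇ⇒≤ x 1 below))) (at-least-two wide))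
  , (λ wide → optimal (multiples-dominate (subst (_< n) (+-comm K 1) wide)) (∣multiples∣≤ {n} K)
                      (λ dominating → ceilDiv-least {n} K (gap-bound dominating)))
  where open Broadcast n k t r {{>-nonZero 1≤n}} {{>-nonZero 1≤k}} 1≤r r≤t
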